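{- Consider the single load minimal cache demand problem with $c$ cores and total cache $K$. Let algorithm $A_2$ be: sort the jobs in non-increasing order of cache demand $x_j$; assign them in this order to cores $1,2,\dots$, continuing to assign jobs to the current core until its total load exceeds $1$, then moving to the next core; allocate to each core the cache demand of the first (most demanding) job assigned to it; fail if more than $c$ cores or more than $K$ cache are used. If there is a cache partition and job assignment of makespan at most $1$ that use $c$ cores and $K$ cache, then $A_2$ finds a cache partition and job assignment of makespan at most $2$ that use at most $c$ cores and at most $K$ cache.
   Context: Single load minimal cache demand problem: each job $j$ has a load $a_j>0$ and a minimal cache demand $x_j\ge0$. A solution is a cache partition $p$ giving $p(i)\ge0$ cache to each of the $c$ cores with $\sum_ip(i)\le K$ (this sum is the cache used), and an assignment $S$ of jobs to cores such that every job $j$ is assigned to a core with $p(S(j))\ge x_j$. The load of a core is the sum of $a_j$ over jobs assigned to it, and the makespan is the maximum load of a core.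
   Formalization: The loads $a_j$, the cache demands $x_j$, the total cache $K$ and the cache allocations $p(i)$ are rational. -}

module Defs where

open import Data.Nat as ℕ using (ℕ; zero; suc)
open import Data.Fin as Fin using (Fin; toℕ)
open import Data.Fin.Properties using () renaming (_≟_ to _≟ᶠ_)
open import Data.List using (List; []; _∷_; map; filter; reverse; length; allFin)
import Data.List.Membership.DecPropositional as DecMem
open import Data.Product using (_×_)
open import Data.Rational using (ℚ; 0ℚ; 1ℚ; _+_; _≤_; _<_)
open import Data.Rational.Properties using (_<?_)
open import Relation.Nullary using (yes; no)
open import Relation.Binary.PropositionalEquality using (_≡_)

sumℚ : List ℚ → ℚ
sumℚ = Data.List.foldr _+_ 0ℚ

record Solution (n c : ℕ) : Set where
  constructor ⟨_,_⟩
  field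
    part   : Fin c → ℚ
    assign : Fin n → Fin c
open Solution public

cacheUsed : ∀ {n c} → Solution n c → ℚ
cacheUsed {c = c} s = sumℚ (map (part s) (allFin c))

load : ∀ {n c} → (Fin n → ℚ) → Solution n c → Fin c → ℚ
load {n} a s i = sumℚ (map a (filter (λ j → assign s j ≟ᶠ i) (allFin n)))

Valid : ∀ {n c} → (x : Fin n → ℚ) → (K : ℚ) → Solution n c → Set
Valid {n} {c} x K s =
  (∀ (i : Fin c) → 0ℚ ≤ part s i) ×′
  ((cacheUsed s ≤ K) ×′ (∀ (j : Fin n) → x j ≤ part s (assign s j)))
  where
  open import Data.Product using () renaming (_×_ to _×′_)

MakespanAtMost : ∀ {n c} → (Fin n → ℚ) → Solution n c → ℚ → Set
MakespanAtMost {c = c} a s T = ∀ (i : Fin c) → load a s i ≤ T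

-- Algorithm A₂ (greedy), run on a given processing order of the jobs.
-- Produces the list of blocks: block k is the list of jobs on core k
-- (cores numbered 0,1,2,...), in assignment order.

module _ {n : ℕ} (a : Fin n → ℚ) where
  -- cur : jobs already on the current core (reversed), L : its load
  greedyGo : List (Fin n) → ℚ → List (Fin n) → List (List (Fin n))
  greedyGo []  L [] = []
  greedyGo cur@(_ ∷ _) L [] = reverse cur ∷ []
  greedyGo cur L (j ∷ js) with 1ℚ <? (L + a j)
  ... | yes _ = reverse (j ∷ cur) ∷ greedyGo [] 0ℚ js
  ... | no  _ = greedyGo (j ∷ cur) (L + a j) js

  greedyBlocks : List (Fin n) → List (List (Fin n))
  greedyBlocks order = greedyGo [] 0ℚ order

blockCache : ∀ {n} → (Fin n → ℚ) → List (Fin n) → ℚ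
blockCache x []      = 0ℚ
blockCache x (j ∷ _) = x j

greedyCache : ∀ {n} → (Fin n → ℚ) → List (List (Fin n)) → ℚ
greedyCache x B = sumℚ (map (blockCache x) B)

cacheOfCore : ∀ {n} → (Fin n → ℚ) → List (List (Fin n)) → ℕ → ℚ
cacheOfCore x []      k       = 0ℚ
cacheOfCore x (b ∷ B) zero    = blockCache x b
cacheOfCore x (b ∷ B) (suc k) = cacheOfCore x B k

-- core number A₂ assigns job j to (index of the block containing j;
-- equals length B if j is in no block)
coreOf : ∀ {n} → List (List (Fin n)) → Fin n → ℕ
coreOf []      j = zero
coreOf {n} (b ∷ B) j with DecMem._∈?_ (_≟ᶠ_ {n}) j b
... | yes _ = zero
... | no  _ = suc (coreOf B j)

-- "A₂ run on `order` succeeds and outputs the solution s":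
-- it uses at most c cores and at most K cache (so it does not fail),
-- and s is exactly the partition/assignment it constructs.
A₂Outputs : ∀ {n c} → (a x : Fin n → ℚ) → (K : ℚ) →
            List (Fin n) → Solution n c → Set
A₂Outputs {n} {c} a x K order s =
  (length B ℕ.≤ c) ×′
  ((greedyCache x B ≤ K) ×′
  ((∀ (j : Fin n) → toℕ (assign s j) ≡ coreOf B j) ×′
   (∀ (i : Fin c) → part s i ≡ cacheOfCore x B (toℕ i))))
  where
  open import Data.Product using () renaming (_×_ to _×′_)
  B = greedyBlocks a order

module Submission where

-- A₂ cuts the sorted job list into blocks; every block but the last has load > 1, and every
-- block has load ≤ 2 because a single job fits on a core of load ≤ 1.  Let f be the head of
-- block k.  The jobs up to f have load > k and all need cache ≥ x f, so in the given solution
-- they lie on cores of cache ≥ x f, each of load ≤ 1: more than k cores have cache ≥ x f.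
-- The heads are non-increasing, so they can be matched greedily to distinct cores of at least
-- their size.  Hence A₂ uses at most c cores and, since a core gets the cache of its head,
-- at most as much cache as the given solution.

open import Defs
open import Data.Bool using (Bool; true; false; if_then_else_)
open import Data.Nat as ℕ using (ℕ; zero; suc; s≤s; z≤n)
import Data.Nat.Properties as ℕ
open import Data.Fin as Fin using (Fin; toℕ; fromℕ<)
open import Data.Fin.Properties using (toℕ-injective; toℕ-fromℕ<) renaming (_≟_ to _≟ᶠ_)
open import Data.List using (List; []; _∷_; _++_; [_]; map; filter; concat; reverse; length; allFin)
open import Data.List.Properties using (++-assoc; length-map; length-tabulate; map-++; map-∘; map-tabulate; length-reverse; ʳ++-defn)
open import Data.List.Membership.Propositional using (_∈_; _∉_; find)
open import Data.List.Membership.Propositional.Properties using (∈-∃++; ∈-++⁺ʳ; ∈-++⁺ˡ; ∈-++⁻; ∈-allFin; ∈-filter⁺)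
open import Data.List.Relation.Unary.All as All using (All; []; _∷_)
import Data.List.Relation.Unary.All.Properties as All
open import Data.List.Relation.Unary.AllPairs using (AllPairs; []; _∷_)
open import Data.List.Relation.Unary.Any using (Any; here; there)
open import Data.List.Relation.Unary.Linked using (Linked)
open import Data.List.Relation.Unary.Linked.Properties using (Linked⇒AllPairs)
open import Data.List.Relation.Unary.Unique.Propositional using (Unique)
open import Data.List.Relation.Unary.Unique.Propositional.Properties using (allFin⁺)
open import Data.List.Relation.Binary.Permutation.Propositional using (_↭_; ↭-sym; ↭⇒↭ₛ)
open import Data.List.Relation.Binary.Permutation.Propositional.Properties
  using (map⁺; shift; All-resp-↭; ↭-reverse; ↭-length; ∈-resp-↭)
import Data.List.Relation.Binary.Permutation.Setoid.Properties as ↭ₛ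
import Data.List.Membership.DecPropositional as DecMembership
open import Data.Rational using (ℚ; 0ℚ; 1ℚ; _+_; _≤_; _<_)
open import Data.Rational.Properties
open import Data.Product using (Σ; _×_; _,_; proj₁; proj₂)
open import Data.Sum using (inj₁; inj₂)
open import Function using (_∘_; mk⇔)
open import Relation.Nullary using (Dec; yes; no; does; ¬_; contradiction)
open import Relation.Nullary.Decidable using (does-⇔)
open import Relation.Binary.PropositionalEquality hiding ([_])

open import Algebra.Bundles using (CommutativeMonoid)
open import Algebra.Properties.CommutativeSemigroup
  (CommutativeMonoid.commutativeSemigroup +-0-commutativeMonoid) using (interchange)

0≤1 : 0ℚ ≤ 1ℚ
0≤1 = <⇒≤ (positive⁻¹ 1ℚ)

sumℚ-++ : ∀ (xs ys : List ℚ) → sumℚ (xs ++ ys) ≡ sumℚ xs + sumℚ ys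
sumℚ-++ []       ys = sym (+-identityˡ (sumℚ ys))
sumℚ-++ (x ∷ xs) ys = trans (cong (x +_) (sumℚ-++ xs ys)) (sym (+-assoc x (sumℚ xs) (sumℚ ys)))

sumℚ-↭ : ∀ {xs ys : List ℚ} → xs ↭ ys → sumℚ xs ≡ sumℚ ys
sumℚ-↭ p = ↭ₛ.foldr-commMonoid (setoid ℚ) +-0-isCommutativeMonoid (↭⇒↭ₛ p)

sumℚ-nonneg : ∀ {xs} → All (0ℚ ≤_) xs → 0ℚ ≤ sumℚ xs
sumℚ-nonneg []          = ≤-refl
sumℚ-nonneg (0≤x ∷ 0≤xs) = +-mono-≤ 0≤x (sumℚ-nonneg 0≤xs)

module _ {A : Set} where

  sumℚ-map-↭ : ∀ (f : A → ℚ) {xs ys} → xs ↭ ys → sumℚ (map f xs) ≡ sumℚ (map f ys)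
  sumℚ-map-↭ f p = sumℚ-↭ (map⁺ f p)

  sumℚ-map-zero : ∀ (xs : List A) → sumℚ (map (λ _ → 0ℚ) xs) ≡ 0ℚ
  sumℚ-map-zero []       = refl
  sumℚ-map-zero (_ ∷ xs) = trans (+-identityˡ _) (sumℚ-map-zero xs)

  sumℚ-map-cong : ∀ {f g : A → ℚ} {xs} → All (λ j → f j ≡ g j) xs → sumℚ (map f xs) ≡ sumℚ (map g xs)
  sumℚ-map-cong []       = refl
  sumℚ-map-cong (e ∷ es) = cong₂ _+_ e (sumℚ-map-cong es)

  sumℚ-map-mono : ∀ {f g : A → ℚ} (xs : List A) → (∀ j → f j ≤ g j) → sumℚ (map f xs) ≤ sumℚ (map g xs)
  sumℚ-map-mono []       f≤g = ≤-refl
  sumℚ-map-mono (x ∷ xs) f≤g = +-mono-≤ (f≤g x) (sumℚ-map-mono xs f≤g)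

  sumℚ-map-nonneg : ∀ {f : A → ℚ} (xs : List A) → (∀ j → 0ℚ ≤ f j) → 0ℚ ≤ sumℚ (map f xs)
  sumℚ-map-nonneg xs 0≤f = sumℚ-nonneg (All.map⁺ (All.universal 0≤f xs))

  sumℚ-map-+ : ∀ (f g : A → ℚ) (xs : List A) →
               sumℚ (map (λ j → f j + g j) xs) ≡ sumℚ (map f xs) + sumℚ (map g xs)
  sumℚ-map-+ f g []       = sym (+-identityˡ 0ℚ)
  sumℚ-map-+ f g (x ∷ xs) =
    trans (cong (f x + g x +_) (sumℚ-map-+ f g xs))
          (interchange (f x) (g x) (sumℚ (map f xs)) (sumℚ (map g xs)))

  sumℚ-map-++ : ∀ (f : A → ℚ) xs ys → sumℚ (map f (xs ++ ys)) ≡ sumℚ (map f xs) + sumℚ (map f ys)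
  sumℚ-map-++ f xs ys = trans (cong sumℚ (map-++ f xs ys)) (sumℚ-++ (map f xs) (map f ys))

  sumℚ-map-++-≤ : ∀ {f : A → ℚ} xs ys → (∀ j → 0ℚ ≤ f j) → sumℚ (map f xs) ≤ sumℚ (map f (xs ++ ys))
  sumℚ-map-++-≤ {f} xs ys 0≤f = begin
    sumℚ (map f xs)                      ≡⟨ +-identityʳ _ ⟨
    sumℚ (map f xs) + 0ℚ                 ≤⟨ +-monoʳ-≤ (sumℚ (map f xs)) (sumℚ-map-nonneg ys 0≤f) ⟩
    sumℚ (map f xs) + sumℚ (map f ys)    ≡⟨ sumℚ-map-++ f xs ys ⟨
    sumℚ (map f (xs ++ ys))              ∎
    where open ≤-Reasoning

  ∈⇒≤sumℚ : ∀ {f : A → ℚ} {j xs} → (∀ j → 0ℚ ≤ f j) → j ∈ xs → f j ≤ sumℚ (map f xs)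
  ∈⇒≤sumℚ {f} {xs = x ∷ xs} 0≤f (here refl) =
    subst (_≤ f x + sumℚ (map f xs)) (+-identityʳ (f x)) (+-monoʳ-≤ (f x) (sumℚ-map-nonneg xs 0≤f))
  ∈⇒≤sumℚ {f} {j} {x ∷ xs} 0≤f (there j∈xs) =
    subst (_≤ f x + sumℚ (map f xs)) (+-identityˡ (f j)) (+-mono-≤ (0≤f x) (∈⇒≤sumℚ 0≤f j∈xs))

sumℚ-map-comm : ∀ {A B : Set} (f : A → B → ℚ) (is : List A) (js : List B) →
                sumℚ (map (λ i → sumℚ (map (f i) js)) is) ≡ sumℚ (map (λ j → sumℚ (map (λ i → f i j) is)) js)
sumℚ-map-comm f []       js = sym (sumℚ-map-zero js)
sumℚ-map-comm f (i ∷ is) js =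
  trans (cong (sumℚ (map (f i) js) +_) (sumℚ-map-comm f is js))
        (sym (sumℚ-map-+ (f i) (λ j → sumℚ (map (λ i → f i j) is)) js))

sumℚ-allFin-suc : ∀ {c} (f : Fin (suc c) → ℚ) →
                  sumℚ (map f (allFin (suc c))) ≡ f Fin.zero + sumℚ (map (f ∘ Fin.suc) (allFin c))
sumℚ-allFin-suc {c} f =
  cong (λ xs → f Fin.zero + sumℚ xs) (trans (map-tabulate Fin.suc f) (sym (map-tabulate (λ i → i) (f ∘ Fin.suc))))

indicator : Bool → ℚ → ℚ
indicator b v = if b then v else 0ℚ

indicator-yes : ∀ {P : Set} (P? : Dec P) {v} → P → indicator (does P?) v ≡ v
indicator-yes (yes _) _  = refl
indicator-yes (no ¬p) p = contradiction p ¬p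

indicator-no : ∀ {P : Set} (P? : Dec P) {v} → ¬ P → indicator (does P?) v ≡ 0ℚ
indicator-no (yes p) ¬p = contradiction p ¬p
indicator-no (no _)  _  = refl

indicator-nonneg : ∀ b {v} → 0ℚ ≤ v → 0ℚ ≤ indicator b v
indicator-nonneg true  0≤v = 0≤v
indicator-nonneg false _   = ≤-refl

indicator-mono : ∀ b {v w} → v ≤ w → indicator b v ≤ indicator b w
indicator-mono true  v≤w = v≤w
indicator-mono false _   = ≤-refl

module _ {A : Set} where

  sumℚ-map-indicator : ∀ b (f : A → ℚ) xs →
                       sumℚ (map (λ j → indicator b (f j)) xs) ≡ indicator b (sumℚ (map f xs))
  sumℚ-map-indicator true  f xs = refl
  sumℚ-map-indicator false f xs = sumℚ-map-zero xs

  sumℚ-filter : ∀ {P : A → Set} (P? : ∀ j → Dec (P j)) (f : A → ℚ) xs →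
                sumℚ (map f (filter P? xs)) ≡ sumℚ (map (λ j → indicator (does (P? j)) (f j)) xs)
  sumℚ-filter P? f []       = refl
  sumℚ-filter P? f (x ∷ xs) with does (P? x)
  ... | true  = cong (f x +_) (sumℚ-filter P? f xs)
  ... | false = trans (sumℚ-filter P? f xs) (sym (+-identityˡ _))

sumℚ-allFin-≟ : ∀ {c} (k : Fin c) (w : Fin c → ℚ) →
                sumℚ (map (λ i → indicator (does (k ≟ᶠ i)) (w i)) (allFin c)) ≡ w k
sumℚ-allFin-≟ {suc c} Fin.zero w =
  trans (sumℚ-allFin-suc (λ i → indicator (does (Fin.zero ≟ᶠ i)) (w i)))
        (trans (cong (w Fin.zero +_) (sumℚ-map-zero (allFin c))) (+-identityʳ _))
sumℚ-allFin-≟ {suc c} (Fin.suc k) w =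
  trans (sumℚ-allFin-suc (λ i → indicator (does (Fin.suc k ≟ᶠ i)) (w i)))
        (trans (+-identityˡ _) (sumℚ-allFin-≟ k (w ∘ Fin.suc)))

sumℚ-fibres : ∀ {A : Set} {c} (σ : A → Fin c) (f : A → ℚ) xs →
              sumℚ (map f xs) ≡ sumℚ (map (λ i → sumℚ (map f (filter (λ j → σ j ≟ᶠ i) xs))) (allFin c))
sumℚ-fibres {c = c} σ f xs = begin
  sumℚ (map f xs)
    ≡⟨ sumℚ-map-cong (All.universal (λ j → sym (sumℚ-allFin-≟ (σ j) (λ _ → f j))) xs) ⟩
  sumℚ (map (λ j → sumℚ (map (λ i → δ i j) (allFin c))) xs)
    ≡⟨ sumℚ-map-comm (λ j i → δ i j) xs (allFin c) ⟩
  sumℚ (map (λ i → sumℚ (map (δ i) xs)) (allFin c))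
    ≡⟨ sumℚ-map-cong (All.universal (λ i → sumℚ-filter (λ j → σ j ≟ᶠ i) f xs) (allFin c)) ⟨
  sumℚ (map (λ i → sumℚ (map f (filter (λ j → σ j ≟ᶠ i) xs))) (allFin c)) ∎
  where
  open ≡-Reasoning
  δ : Fin c → _ → ℚ
  δ i j = indicator (does (σ j ≟ᶠ i)) (f j)

-- Thresholds dominated by a list of capacities

count≥ : ℚ → List ℚ → ℚ
count≥ t ps = sumℚ (map (λ q → indicator (does (t ≤? q)) 1ℚ) ps)

count≥-remove : ∀ {t q} pre post → t ≤ q → count≥ t (pre ++ q ∷ post) ≡ count≥ t (pre ++ post) + 1ℚ
count≥-remove {t} {q} pre post t≤q = begin
  count≥ t (pre ++ q ∷ post)                            ≡⟨ sumℚ-map-↭ _ (shift q pre post) ⟩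
  indicator (does (t ≤? q)) 1ℚ + count≥ t (pre ++ post)
    ≡⟨ cong (_+ count≥ t (pre ++ post)) (indicator-yes (t ≤? q) t≤q) ⟩
  1ℚ + count≥ t (pre ++ post)                           ≡⟨ +-comm 1ℚ (count≥ t (pre ++ post)) ⟩
  count≥ t (pre ++ post) + 1ℚ                           ∎
  where open ≡-Reasoning

count≥-pos⇒Any : ∀ {t} ps → 0ℚ < count≥ t ps → Any (t ≤_) ps
count≥-pos⇒Any     []       0<0     = contradiction 0<0 (<-irrefl refl)
count≥-pos⇒Any {t} (q ∷ ps) 0<count with t ≤? q
... | yes t≤q = here t≤q
... | no  t≰q = there (count≥-pos⇒Any ps (subst (0ℚ <_) count≡ 0<count))
  where
  count≡ : count≥ t (q ∷ ps) ≡ count≥ t ps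
  count≡ = trans (cong (_+ count≥ t ps) (indicator-no (t ≤? q) t≰q)) (+-identityˡ _)

+-cancelʳ-< : ∀ r {p q} → p + r < q + r → p < q
+-cancelʳ-< r {p} {q} p+r<q+r with p <? q
... | yes p<q = p<q
... | no  p≮q = contradiction (<-≤-trans p+r<q+r (+-monoˡ-≤ r (≮⇒≥ p≮q))) (<-irrefl refl)

-- Fits ps m ts: ts is non-increasing and, for every k, more than m + k entries of ps are ≥ its k-th entry.
data Fits (ps : List ℚ) : ℚ → List ℚ → Set where
  done : ∀ {m} → Fits ps m []
  next : ∀ {m t ts} → m < count≥ t ps → All (_≤ t) ts → Fits ps (m + 1ℚ) ts → Fits ps m (t ∷ ts)

Fits-remove : ∀ {q m ts} pre post → All (_≤ q) ts → Fits (pre ++ q ∷ post) (m + 1ℚ) ts → Fits (pre ++ post) m ts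
Fits-remove pre post [] done = done
Fits-remove {m = m} pre post (t≤q ∷ ts≤q) (next m+1<count ts≤t rest) =
  next (+-cancelʳ-< 1ℚ (subst (m + 1ℚ <_) (count≥-remove pre post t≤q) m+1<count))
       ts≤t
       (Fits-remove pre post ts≤q rest)

-- Greedy matching: the largest threshold t is matched to some capacity q ≥ t, which is then removed.
Fits⇒≤ : ∀ {ps m ts} → All (0ℚ ≤_) ps → 0ℚ ≤ m → Fits ps m ts →
         sumℚ ts ≤ sumℚ ps × length ts ℕ.≤ length ps
Fits⇒≤ 0≤ps 0≤m done = sumℚ-nonneg 0≤ps , z≤n
Fits⇒≤ {ps} 0≤ps 0≤m (next m<count ts≤t rest)
  with q , q∈ps , t≤q ← find (count≥-pos⇒Any ps (≤-<-trans 0≤m m<count))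
  with pre , post , refl ← ∈-∃++ q∈ps
  with ih-sum , ih-length ← Fits⇒≤ (All.tail (All-resp-↭ (shift q pre post) 0≤ps)) 0≤m
                                   (Fits-remove pre post (All.map (λ u≤t → ≤-trans u≤t t≤q) ts≤t) rest)
  = ≤-trans (+-mono-≤ t≤q ih-sum) (≤-reflexive (sym (sumℚ-↭ (shift q pre post))))
  , ℕ.≤-trans (s≤s ih-length) (ℕ.≤-reflexive (sym (↭-length (shift q pre post))))

-- The blocks built by A₂

reverse-∷-++ : ∀ {A : Set} (x : A) xs ys → reverse (x ∷ xs) ++ ys ≡ reverse xs ++ x ∷ ys
reverse-∷-++ x xs ys = trans (sym (ʳ++-defn (x ∷ xs))) (ʳ++-defn xs)

Unique-resp-↭ : ∀ {A : Set} {xs ys : List A} → xs ↭ ys → Unique xs → Unique ys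
Unique-resp-↭ {A} p = ↭ₛ.Unique-resp-↭ (setoid A) (↭⇒↭ₛ p)

module _ {A : Set} {R : A → A → Set} where

  AllPairs-++⁻ʳ : ∀ xs {ys} → AllPairs R (xs ++ ys) → AllPairs R ys
  AllPairs-++⁻ʳ []       Rs       = Rs
  AllPairs-++⁻ʳ (_ ∷ xs) (_ ∷ Rs) = AllPairs-++⁻ʳ xs Rs

  AllPairs-++-∷⁻ : ∀ xs {y ys} → AllPairs R (xs ++ y ∷ ys) → All (λ x → R x y) xs × All (R y) ys
  AllPairs-++-∷⁻ []       (Ry ∷ _)  = [] , Ry
  AllPairs-++-∷⁻ (_ ∷ xs) (Rx ∷ Rs) with before , after ← AllPairs-++-∷⁻ xs Rs =
    All.lookup Rx (∈-++⁺ʳ xs (here refl)) ∷ before , after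

Unique-++⇒∉ : ∀ {A : Set} xs {ys} {j : A} → Unique (xs ++ ys) → j ∈ ys → j ∉ xs
Unique-++⇒∉ (x ∷ xs) (x∉ ∷ _) j∈ys (here refl) = All.lookup x∉ (∈-++⁺ʳ xs j∈ys) refl
Unique-++⇒∉ (x ∷ xs) (_ ∷ u)  j∈ys (there j∈xs) = Unique-++⇒∉ xs u j∈ys j∈xs

blockAt : ∀ {A : Set} → List (List A) → ℕ → List A
blockAt []      k       = []
blockAt (b ∷ B) zero    = b
blockAt (b ∷ B) (suc k) = blockAt B k

module _ {n : ℕ} (a : Fin n → ℚ) where

  blockLoad : List (Fin n) → ℚ
  blockLoad b = sumℚ (map a b)

  data Packing : List (List (Fin n)) → Set where
    []     : Packing []
    last   : ∀ {b} → b ≢ [] → blockLoad b ≤ 1ℚ + 1ℚ → Packing (b ∷ [])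
    closed : ∀ {b B} → 1ℚ < blockLoad b → blockLoad b ≤ 1ℚ + 1ℚ → Packing B → Packing (b ∷ B)

  -- greedyGo matches on cur before js, so its step only unfolds once cur is split.
  greedyGo-concat : ∀ cur L js → concat (greedyGo a cur L js) ≡ reverse cur ++ js
  greedyGo-concat []       L []       = refl
  greedyGo-concat (_ ∷ _)  L []       = refl
  greedyGo-concat []       L (j ∷ js) with 1ℚ <? L + a j
  ... | yes _ = cong (j ∷_) (greedyGo-concat [] 0ℚ js)
  ... | no  _ = greedyGo-concat (j ∷ []) (L + a j) js
  greedyGo-concat (c ∷ cs) L (j ∷ js) with 1ℚ <? L + a j
  ... | yes _ = trans (cong (reverse (j ∷ c ∷ cs) ++_) (greedyGo-concat [] 0ℚ js)) (reverse-∷-++ j (c ∷ cs) js)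
  ... | no  _ = trans (greedyGo-concat (j ∷ c ∷ cs) (L + a j) js) (reverse-∷-++ j (c ∷ cs) js)

  greedyBlocks-concat : ∀ order → concat (greedyBlocks a order) ≡ order
  greedyBlocks-concat = greedyGo-concat [] 0ℚ

  module _ (a≤1 : ∀ j → a j ≤ 1ℚ) where

    private
      blockLoad-reverse : ∀ b → blockLoad (reverse b) ≡ blockLoad b
      blockLoad-reverse b = sumℚ-map-↭ a (↭-reverse b)

      blockLoad-push : ∀ {L} j cur → L ≡ blockLoad cur → L + a j ≡ blockLoad (j ∷ cur)
      blockLoad-push {L} j cur L≡ = trans (+-comm L (a j)) (cong (a j +_) L≡)

      blockLoad-close : ∀ {L} j cur → L ≡ blockLoad cur → L + a j ≡ blockLoad (reverse (j ∷ cur))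
      blockLoad-close j cur L≡ = trans (blockLoad-push j cur L≡) (sym (blockLoad-reverse (j ∷ cur)))

      1≤2 : 1ℚ ≤ 1ℚ + 1ℚ
      1≤2 = subst (_≤ 1ℚ + 1ℚ) (+-identityʳ 1ℚ) (+-monoʳ-≤ 1ℚ 0≤1)

    greedyGo-packing : ∀ cur L js → L ≡ blockLoad cur → L ≤ 1ℚ → Packing (greedyGo a cur L js)
    overflow-packing : ∀ cur L j js → L ≡ blockLoad cur → L ≤ 1ℚ → 1ℚ < L + a j →
                       Packing (reverse (j ∷ cur) ∷ greedyGo a [] 0ℚ js)

    greedyGo-packing []       L []       _  _   = []
    greedyGo-packing (c ∷ cs) L []       L≡ L≤1 =
      last reverse≢[] (≤-trans (≤-reflexive (trans (blockLoad-reverse (c ∷ cs)) (sym L≡))) (≤-trans L≤1 1≤2))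
      where
      reverse≢[] : reverse (c ∷ cs) ≢ []
      reverse≢[] e = ℕ.0≢1+n (trans (sym (cong length e)) (length-reverse (c ∷ cs)))
    greedyGo-packing []       L (j ∷ js) L≡ L≤1 with 1ℚ <? L + a j
    ... | yes over = overflow-packing [] L j js L≡ L≤1 over
    ... | no  fits = greedyGo-packing (j ∷ []) (L + a j) js (blockLoad-push j [] L≡) (≮⇒≥ fits)
    greedyGo-packing (c ∷ cs) L (j ∷ js) L≡ L≤1 with 1ℚ <? L + a j
    ... | yes over = overflow-packing (c ∷ cs) L j js L≡ L≤1 over
    ... | no  fits = greedyGo-packing (j ∷ c ∷ cs) (L + a j) js (blockLoad-push j (c ∷ cs) L≡) (≮⇒≥ fits)

    overflow-packing cur L j js L≡ L≤1 over =
      closed (subst (1ℚ <_) (blockLoad-close j cur L≡) over)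
             (subst (_≤ 1ℚ + 1ℚ) (blockLoad-close j cur L≡) (+-mono-≤ L≤1 (a≤1 j)))
             (greedyGo-packing [] 0ℚ js refl 0≤1)

    greedyBlocks-packing : ∀ order → Packing (greedyBlocks a order)
    greedyBlocks-packing order = greedyGo-packing [] 0ℚ order refl 0≤1

module _ {n : ℕ} where

  open DecMembership (_≟ᶠ_ {n}) using (_∈?_)

  coreOf-< : ∀ B {j : Fin n} → j ∈ concat B → coreOf B j ℕ.< length B
  coreOf-< (b ∷ B) {j} j∈ with j ∈? b
  ... | yes _   = s≤s z≤n
  ... | no  j∉b with ∈-++⁻ b j∈
  ...   | inj₁ j∈b = contradiction j∈b j∉b
  ...   | inj₂ j∈B = s≤s (coreOf-< B j∈B)

  coreOf-∈ : ∀ b B {j : Fin n} → j ∈ b → coreOf (b ∷ B) j ≡ 0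
  coreOf-∈ b B {j} j∈b with j ∈? b
  ... | yes _   = refl
  ... | no  j∉b = contradiction j∈b j∉b

  coreOf-∉ : ∀ b B {j : Fin n} → j ∉ b → coreOf (b ∷ B) j ≡ suc (coreOf B j)
  coreOf-∉ b B {j} j∉b with j ∈? b
  ... | yes j∈b = contradiction j∈b j∉b
  ... | no  _   = refl

  sumℚ-coreOf-∷ : ∀ (w : Fin n → ℚ) b B → Unique (concat (b ∷ B)) → ∀ k →
                  sumℚ (map (λ j → indicator (does (coreOf (b ∷ B) j ℕ.≟ k)) (w j)) (concat (b ∷ B)))
                ≡ sumℚ (map (λ j → indicator (does (0 ℕ.≟ k)) (w j)) b)
                  + sumℚ (map (λ j → indicator (does (suc (coreOf B j) ℕ.≟ k)) (w j)) (concat B))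
  sumℚ-coreOf-∷ w b B u k =
    trans (sumℚ-map-++ δ b (concat B))
          (cong₂ _+_ (sumℚ-map-cong (All.tabulate (λ j∈b → cong (λ core → indicator (does (core ℕ.≟ k)) _)
                                                                 (coreOf-∈ b B j∈b))))
                     (sumℚ-map-cong (All.tabulate (λ j∈B → cong (λ core → indicator (does (core ℕ.≟ k)) _)
                                                                 (coreOf-∉ b B (Unique-++⇒∉ b u j∈B))))))
    where
    δ : Fin n → ℚ
    δ j = indicator (does (coreOf (b ∷ B) j ℕ.≟ k)) (w j)

  sumℚ-coreOf : ∀ (w : Fin n → ℚ) B → Unique (concat B) → ∀ k →
                sumℚ (map (λ j → indicator (does (coreOf B j ℕ.≟ k)) (w j)) (concat B)) ≡ sumℚ (map w (blockAt B k))
  sumℚ-coreOf w []      _ k       = refl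
  sumℚ-coreOf w (b ∷ B) u zero    =
    trans (sumℚ-coreOf-∷ w b B u zero)
          (trans (cong (sumℚ (map w b) +_) (sumℚ-map-zero (concat B))) (+-identityʳ (sumℚ (map w b))))
  sumℚ-coreOf w (b ∷ B) u (suc k) =
    trans (sumℚ-coreOf-∷ w b B u (suc k))
          (trans (cong (_+ rest) (sumℚ-map-zero b))
                 (trans (+-identityˡ rest) (sumℚ-coreOf w B (AllPairs-++⁻ʳ b u) k)))
    where
    rest : ℚ
    rest = sumℚ (map (λ j → indicator (does (coreOf B j ℕ.≟ k)) (w j)) (concat B))

  module _ (x : Fin n → ℚ) where

    cacheOfCore-nonneg : (∀ j → 0ℚ ≤ x j) → ∀ B k → 0ℚ ≤ cacheOfCore x B k
    cacheOfCore-nonneg 0≤x []             k       = ≤-refl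
    cacheOfCore-nonneg 0≤x ([] ∷ B)       zero    = ≤-refl
    cacheOfCore-nonneg 0≤x ((f ∷ _) ∷ B)  zero    = 0≤x f
    cacheOfCore-nonneg 0≤x (_ ∷ B)        (suc k) = cacheOfCore-nonneg 0≤x B k

    sumℚ-cacheOfCore : ∀ c B → length B ℕ.≤ c →
                       sumℚ (map (λ i → cacheOfCore x B (toℕ i)) (allFin c)) ≡ greedyCache x B
    sumℚ-cacheOfCore c       []      _         = sumℚ-map-zero (allFin c)
    sumℚ-cacheOfCore (suc c) (b ∷ B) (s≤s B≤c) =
      trans (sumℚ-allFin-suc {c} (λ i → cacheOfCore x (b ∷ B) (toℕ i)))
            (cong (blockCache x b +_) (sumℚ-cacheOfCore c B B≤c))

    x≤cacheOfCore-coreOf : ∀ B {j} → AllPairs (λ i j → x j ≤ x i) (concat B) → j ∈ concat B →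
                           x j ≤ cacheOfCore x B (coreOf B j)
    x≤cacheOfCore-coreOf (b ∷ B) {j} sorted j∈ with j ∈? b
    x≤cacheOfCore-coreOf ((f ∷ bs) ∷ B) _         _ | yes (here refl)  = ≤-refl
    x≤cacheOfCore-coreOf ((f ∷ bs) ∷ B) (x≤f ∷ _) _ | yes (there j∈bs) = All.lookup x≤f (∈-++⁺ˡ j∈bs)
    ... | no  j∉b with ∈-++⁻ b j∈
    ...   | inj₁ j∈b = contradiction j∈b j∉b
    ...   | inj₂ j∈B = x≤cacheOfCore-coreOf B (AllPairs-++⁻ʳ b sorted) j∈B

    blockCache-≤ : ∀ B {v} → 0ℚ ≤ v → All (λ j → x j ≤ v) (concat B) → All (_≤ v) (map (blockCache x) B)
    blockCache-≤ []             0≤v _            = []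
    blockCache-≤ ([] ∷ B)       0≤v x≤v          = 0≤v ∷ blockCache-≤ B 0≤v x≤v
    blockCache-≤ ((f ∷ bs) ∷ B) 0≤v (xf≤v ∷ x≤v) = xf≤v ∷ blockCache-≤ B 0≤v (All.++⁻ʳ bs x≤v)

-- Bounds from a solution of makespan at most 1

capacities : ∀ {n c} → Solution n c → List ℚ
capacities {c = c} s = map (part s) (allFin c)

length-capacities : ∀ {n c} (s : Solution n c) → length (capacities s) ≡ c
length-capacities {c = c} s = trans (length-map (part s) (allFin c)) (length-tabulate (λ i → i))

module _ {n c : ℕ} (a x : Fin n → ℚ) (s : Solution n c) (0≤a : ∀ j → 0ℚ ≤ a j) where

  a≤load : ∀ j → a j ≤ load a s (assign s j)
  a≤load j = ∈⇒≤sumℚ 0≤a (∈-filter⁺ (λ k → assign s k ≟ᶠ assign s j) (∈-allFin j) refl)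

  -- Jobs needing cache ≥ t run on cores with capacity ≥ t, each carrying load ≤ 1.
  load≤count≥ : (∀ j → x j ≤ part s (assign s j)) → MakespanAtMost a s 1ℚ →
                ∀ {t} P R → P ++ R ↭ allFin n → All (λ j → t ≤ x j) P →
                sumℚ (map a P) ≤ count≥ t (capacities s)
  load≤count≥ covers makespan≤1 {t} P R P++R↭ t≤P = begin
    sumℚ (map a P)
      ≡⟨ sumℚ-map-cong (All.map (λ {j} t≤xj → indicator-yes (t ≤? part s (assign s j)) (≤-trans t≤xj (covers j)))
                                t≤P) ⟨
    sumℚ (map g P)
      ≤⟨ sumℚ-map-++-≤ P R (λ j → indicator-nonneg _ (0≤a j)) ⟩
    sumℚ (map g (P ++ R))
      ≡⟨ sumℚ-map-↭ g P++R↭ ⟩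
    sumℚ (map g (allFin n))
      ≡⟨ sumℚ-fibres (assign s) g (allFin n) ⟩
    sumℚ (map (λ i → sumℚ (map g (filter (λ j → assign s j ≟ᶠ i) (allFin n)))) (allFin c))
      ≡⟨ sumℚ-map-cong (All.universal fibre (allFin c)) ⟩
    sumℚ (map (λ i → indicator (does (t ≤? part s i)) (load a s i)) (allFin c))
      ≤⟨ sumℚ-map-mono (allFin c) (λ i → indicator-mono _ (makespan≤1 i)) ⟩
    sumℚ (map (λ i → indicator (does (t ≤? part s i)) 1ℚ) (allFin c))
      ≡⟨ cong sumℚ (map-∘ (allFin c)) ⟩
    count≥ t (capacities s) ∎
    where
    open ≤-Reasoning
    g : Fin n → ℚ
    g j = indicator (does (t ≤? part s (assign s j))) (a j)
    fibre : ∀ i → sumℚ (map g (filter (λ j → assign s j ≟ᶠ i) (allFin n)))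
                ≡ indicator (does (t ≤? part s i)) (load a s i)
    fibre i = trans (sumℚ-map-cong (All.map (cong (λ k → indicator (does (t ≤? part s k)) _))
                                            (All.all-filter (λ j → assign s j ≟ᶠ i) (allFin n))))
                    (sumℚ-map-indicator (does (t ≤? part s i)) a (filter (λ j → assign s j ≟ᶠ i) (allFin n)))

module _ {n c : ℕ} (a x : Fin n → ℚ) (s : Solution n c)
         (0<a : ∀ j → 0ℚ < a j) (0≤x : ∀ j → 0ℚ ≤ x j)
         (covers : ∀ j → x j ≤ part s (assign s j)) (makespan≤1 : MakespanAtMost a s 1ℚ)
         {order : List (Fin n)} (order↭ : order ↭ allFin n) (sorted : AllPairs (λ i j → x j ≤ x i) order) where

  -- The jobs up to and including f all need cache ≥ x f, and their load exceeds m.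
  head-fits : ∀ {m} P f rest → P ++ f ∷ rest ≡ order → m ≤ sumℚ (map a P) → m < count≥ (x f) (capacities s)
  head-fits {m} P f rest e m≤P = begin-strict
    m                                      ≤⟨ m≤P ⟩
    sumℚ (map a P)                         ≡⟨ +-identityʳ _ ⟨
    sumℚ (map a P) + 0ℚ
      <⟨ +-monoʳ-< (sumℚ (map a P)) (subst (0ℚ <_) (sym (+-identityʳ (a f))) (0<a f)) ⟩
    sumℚ (map a P) + sumℚ (map a [ f ])    ≡⟨ sumℚ-map-++ a P [ f ] ⟨
    sumℚ (map a (P ++ [ f ]))
      ≤⟨ load≤count≥ a x s (<⇒≤ ∘ 0<a) covers makespan≤1 (P ++ [ f ]) rest P++f++rest↭ xf≤ ⟩
    count≥ (x f) (capacities s)            ∎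
    where
    open ≤-Reasoning
    P++f++rest↭ : (P ++ [ f ]) ++ rest ↭ allFin n
    P++f++rest↭ = subst (_↭ allFin n) (sym (trans (++-assoc P [ f ] rest) e)) order↭
    xf≤ : All (λ j → x f ≤ x j) (P ++ [ f ])
    xf≤ = All.++⁺ (proj₁ (AllPairs-++-∷⁻ P (subst (AllPairs _) (sym e) sorted))) (≤-refl ∷ [])

  heads-fit : ∀ {m} P B → Packing a B → P ++ concat B ≡ order → m ≤ sumℚ (map a P) →
              Fits (capacities s) m (map (blockCache x) B)
  heads-fit P []              []                    _ _   = done
  heads-fit P ([] ∷ [])       (last nonempty _)     _ _   = contradiction refl nonempty
  heads-fit P ((f ∷ bs) ∷ []) (last _ _)            e m≤P = next (head-fits P f (bs ++ []) e m≤P) [] done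
  heads-fit P ([] ∷ B)        (closed 1<0 _ _)      _ _   = contradiction 1<0 (<-asym (positive⁻¹ 1ℚ))
  heads-fit {m} P ((f ∷ bs) ∷ B) (closed heavy _ pack) e m≤P =
    next (head-fits P f (bs ++ concat B) e m≤P)
         (blockCache-≤ x B (0≤x f) (All.++⁻ʳ bs (proj₂ (AllPairs-++-∷⁻ P (subst (AllPairs _) (sym e) sorted)))))
         (heads-fit (P ++ f ∷ bs) B pack (trans (++-assoc P (f ∷ bs) (concat B)) e) m+1≤)
    where
    m+1≤ : m + 1ℚ ≤ sumℚ (map a (P ++ f ∷ bs))
    m+1≤ = ≤-trans (+-mono-≤ m≤P (<⇒≤ heavy)) (≤-reflexive (sym (sumℚ-map-++ a P (f ∷ bs))))

module _ {n c : ℕ} (a x : Fin n → ℚ) (B : List (List (Fin n)))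
         (B↭ : concat B ↭ allFin n) (B≤c : length B ℕ.≤ c) where

  ∈-concat : ∀ j → j ∈ concat B
  ∈-concat j = ∈-resp-↭ (↭-sym B↭) (∈-allFin j)

  coreOf<c : ∀ j → coreOf B j ℕ.< c
  coreOf<c j = ℕ.<-≤-trans (coreOf-< B (∈-concat j)) B≤c

  blocksSolution : Solution n c
  blocksSolution = ⟨ (λ i → cacheOfCore x B (toℕ i)) , (λ j → fromℕ< (coreOf<c j)) ⟩

  blocksSolution-valid : ∀ {K} → (∀ j → 0ℚ ≤ x j) → AllPairs (λ i j → x j ≤ x i) (concat B) →
                         greedyCache x B ≤ K →
                         Valid x K blocksSolution
  blocksSolution-valid 0≤x sorted cache≤K =
    (λ i → cacheOfCore-nonneg x 0≤x B (toℕ i)) ,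
    ≤-trans (≤-reflexive (sumℚ-cacheOfCore x c B B≤c)) cache≤K ,
    λ j → subst (λ k → x j ≤ cacheOfCore x B k) (sym (toℕ-fromℕ< (coreOf<c j)))
                (x≤cacheOfCore-coreOf x B sorted (∈-concat j))

  blocksSolution-load : ∀ i → load a blocksSolution i ≡ blockLoad a (blockAt B (toℕ i))
  blocksSolution-load i = begin
    sumℚ (map a (filter (λ j → fromℕ< (coreOf<c j) ≟ᶠ i) (allFin n)))
      ≡⟨ sumℚ-filter (λ j → fromℕ< (coreOf<c j) ≟ᶠ i) a (allFin n) ⟩
    sumℚ (map (λ j → indicator (does (fromℕ< (coreOf<c j) ≟ᶠ i)) (a j)) (allFin n))
      ≡⟨ sumℚ-map-cong (All.universal (λ j → cong (λ b → indicator b (a j)) (same-core j)) (allFin n)) ⟩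
    sumℚ (map g (allFin n))
      ≡⟨ sumℚ-map-↭ g B↭ ⟨
    sumℚ (map g (concat B))
      ≡⟨ sumℚ-coreOf a B (Unique-resp-↭ (↭-sym B↭) (allFin⁺ n)) (toℕ i) ⟩
    blockLoad a (blockAt B (toℕ i)) ∎
    where
    open ≡-Reasoning
    g : Fin n → ℚ
    g j = indicator (does (coreOf B j ℕ.≟ toℕ i)) (a j)
    same-core : ∀ j → does (fromℕ< (coreOf<c j) ≟ᶠ i) ≡ does (coreOf B j ℕ.≟ toℕ i)
    same-core j = does-⇔ (mk⇔ (λ e → trans (sym (toℕ-fromℕ< (coreOf<c j))) (cong toℕ e))
                              (λ e → toℕ-injective (trans (toℕ-fromℕ< (coreOf<c j)) e)))
                         (fromℕ< (coreOf<c j) ≟ᶠ i) (coreOf B j ℕ.≟ toℕ i)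

  blocksSolution-makespan : Packing a B → MakespanAtMost a blocksSolution (1ℚ + 1ℚ)
  blocksSolution-makespan packing i = subst (_≤ 1ℚ + 1ℚ) (sym (blocksSolution-load i)) (blockAt-≤ packing (toℕ i))
    where
    0≤2 : 0ℚ ≤ 1ℚ + 1ℚ
    0≤2 = +-mono-≤ 0≤1 0≤1
    blockAt-≤ : ∀ {B} → Packing a B → ∀ k → blockLoad a (blockAt B k) ≤ 1ℚ + 1ℚ
    blockAt-≤ []                 k       = 0≤2
    blockAt-≤ (last _ ≤2)        zero    = ≤2
    blockAt-≤ (last _ _)         (suc k) = 0≤2
    blockAt-≤ (closed _ ≤2 _)    zero    = ≤2
    blockAt-≤ (closed _ _ pack)  (suc k) = blockAt-≤ pack k

theorem5 : (n c : ℕ) (a x : Fin n → ℚ) (K : ℚ) →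
    (∀ j → 0ℚ < a j) → (∀ j → 0ℚ ≤ x j) →
    (Σ (Solution n c) λ s → Valid x K s × MakespanAtMost a s 1ℚ) →
    (order : List (Fin n)) → order ↭ allFin n →
    Linked (λ i j → x j ≤ x i) order →
    Σ (Solution n c) λ s →
      A₂Outputs a x K order s × Valid x K s × MakespanAtMost a s (1ℚ + 1ℚ)
theorem5 n c a x K 0<a 0≤x (opt , (0≤part , cacheUsed≤K , covers) , makespan≤1) order order↭ linked =
  blocksSolution a x B B↭ B≤c ,
  (B≤c , greedyCache≤K , (λ j → toℕ-fromℕ< (coreOf<c a x B B↭ B≤c j)) , (λ _ → refl)) ,
  blocksSolution-valid a x B B↭ B≤c 0≤x (subst (AllPairs _) (sym concat≡) sorted) greedyCache≤K ,
  blocksSolution-makespan a x B B↭ B≤c packing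
  where
  B : List (List (Fin n))
  B = greedyBlocks a order
  concat≡ : concat B ≡ order
  concat≡ = greedyBlocks-concat a order
  B↭ : concat B ↭ allFin n
  B↭ = subst (_↭ allFin n) (sym concat≡) order↭
  sorted : AllPairs (λ i j → x j ≤ x i) order
  sorted = Linked⇒AllPairs (λ xj≤xi xk≤xj → ≤-trans xk≤xj xj≤xi) linked
  packing : Packing a B
  packing = greedyBlocks-packing a (λ j → ≤-trans (a≤load a x opt (<⇒≤ ∘ 0<a) j) (makespan≤1 (assign opt j)))
                                 order
  bounds : greedyCache x B ≤ cacheUsed opt × length (map (blockCache x) B) ℕ.≤ length (capacities opt)
  bounds = Fits⇒≤ (All.map⁺ (All.universal 0≤part (allFin c))) ≤-refl
                  (heads-fit a x opt 0<a 0≤x covers makespan≤1 order↭ sorted [] B packing concat≡ ≤-refl)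
  greedyCache≤K : greedyCache x B ≤ K
  greedyCache≤K = ≤-trans (proj₁ bounds) cacheUsed≤K
  B≤c : length B ℕ.≤ c
  B≤c = subst₂ ℕ._≤_ (length-map (blockCache x) B) (length-capacities opt) (proj₂ bounds)
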